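{- For every sequence of Linda template fields $\tilde t$, sequence of names $\tilde b$ and substitution $\sigma$: ${\sf Match}(\tilde t;\tilde b)=\sigma$ if and only if $\{{\sf patt}(\tilde t)\|{\sf patb}(\tilde b)\}=(\sigma\cup\{\mathsf n/x\},\{\mathsf n/x_0,\ldots,\mathsf n/x_n\})$, where $\{x_0,\ldots,x_n\}={\sf bn}({\sf patb}(\tilde b))$, ${\sf dom}(\sigma)\uplus\{x\}={\sf bn}({\sf patt}(\tilde t))$, and $\sigma$ maps names to names.
   Context: CPC patterns: $p::=\lambda x\mid x\mid\ulcorner x\urcorner\mid p\bullet p$ (binding, variable, protected name, compound; $\bullet$ left associative); ${\sf bn}(p)$ its binding names; communicable patterns have no protected or binding names. Unification $\{p\|q\}$: $\{x\|x\}=\{x\|\ulcorner x\urcorner\}=\{\ulcorner x\urcorner\|x\}=\{\ulcorner x\urcorner\|\ulcorner x\urcorner\}=(\{\},\{\})$; $\{\lambda x\|q\}=(\{q/x\},\{\})$ if $q$ communicable; $\{p\|\lambda x\}=(\{\},\{p/x\})$ if $p$ communicable; $\{p_1\bullet p_2\|q_1\bullet q_2\}=(\sigma_1\cup\sigma_2,\rho_1\cup\rho_2)$ if $\{p_i\|q_i\}=(\sigma_i,\rho_i)$; undefined otherwise. Linda templates: template fields $t::=\lambda x\mid\ulcorner b\urcorner$ (binding variables pairwise distinct). Matching: ${\sf Match}(\,;\,)=\{\}$, ${\sf Match}(\ulcorner b\urcorner;b)=\{\}$, ${\sf Match}(\lambda x;b)=\{b/x\}$, ${\sf Match}(t,\tilde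 t;b,\tilde b)=\sigma_1\uplus\sigma_2$ if ${\sf Match}(t;b)=\sigma_1$ and ${\sf Match}(\tilde t;\tilde b)=\sigma_2$ ($\uplus$ = union of partial functions with disjoint domains); undefined otherwise. Fix a name $\mathsf n$. ${\sf patt}(\,)=\lambda x\bullet\mathsf n$ with $x$ fresh, ${\sf patt}(t,\tilde t)=t\bullet\mathsf n\bullet{\sf patt}(\tilde t)$ (field $\lambda x$ read as CPC binding name, $\ulcorner b\urcorner$ as CPC protected name); ${\sf patb}(\,)=\mathsf n\bullet\lambda x$, ${\sf patb}(b,\tilde b)=b\bullet\lambda x\bullet{\sf patb}(\tilde b)$, each $x$ a fresh name. In the claim, $x$ denotes the binding name introduced by ${\sf patt}(\,)$ in ${\sf patt}(\tilde t)$. -}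

module Defs where

open import Data.Nat using (ℕ; suc)
open import Data.Nat.Properties using (_≟_)
open import Data.Bool using (Bool; true; false; _∧_; if_then_else_)
open import Data.List using (List; []; _∷_; _++_; map; length)
open import Data.List.Membership.Propositional using (_∈_)
open import Data.Vec using (Vec; []; _∷_)
open import Data.Maybe using (Maybe; just; nothing; _>>=_)
open import Data.Product using (_×_; _,_; proj₁; proj₂; ∃)
open import Relation.Nullary using (yes; no; does)
open import Relation.Binary.PropositionalEquality using (_≡_)

-- Names: an infinite set with decidable equality

Name : Set
Name = ℕ

infixl 5 _•_

data Pat : Set where
  bind : Name → Pat
  var  : Name → Pat
  prot : Name → Pat
  _•_  : Pat → Pat → Pat

bn : Pat → List Name
bn (bind x) = x ∷ []
bn (var x)  = []
bn (prot x) = []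
bn (p • q)  = bn p ++ bn q

communicable : Pat → Bool
communicable (bind x) = false
communicable (var x)  = true
communicable (prot x) = false
communicable (p • q)  = communicable p ∧ communicable q

eqN : Name → Name → Bool
eqN x y = does (x ≟ y)

eqP : Pat → Pat → Bool
eqP (bind x) (bind y) = eqN x y
eqP (var x)  (var y)  = eqN x y
eqP (prot x) (prot y) = eqN x y
eqP (p • q)  (p' • q') = eqP p p' ∧ eqP q q'
eqP _ _ = false

allB : {A : Set} → (A → Bool) → List A → Bool
allB p [] = true
allB p (a ∷ as) = p a ∧ allB p as

-- Substitutions: finite partial functions, represented by association
-- lists; they are compared extensionally (as partial functions).

Subst : Set → Set
Subst A = List (Name × A)

lookup : {A : Set} → Subst A → Name → Maybe A
lookup [] y = nothing
lookup ((x , a) ∷ σ) y = if eqN x y then just a else lookup σ y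

dom : {A : Set} → Subst A → List Name
dom σ = map proj₁ σ

_≈ₛ_ : {A : Set} → Subst A → Subst A → Set
σ ≈ₛ τ = ∀ y → lookup σ y ≡ lookup τ y

_∪ₚ_ : Subst Pat → Subst Pat → Maybe (Subst Pat)
σ ∪ₚ τ =
  if allB (λ { (y , a) → agree (lookup τ y) a }) σ then just (σ ++ τ) else nothing
  where
  agree : Maybe Pat → Pat → Bool
  agree nothing  a = true
  agree (just b) a = eqP a b

_⊎ₙ_ : Subst Name → Subst Name → Maybe (Subst Name)
σ ⊎ₙ τ =
  if allB (λ { (y , a) → free (lookup τ y) }) σ then just (σ ++ τ) else nothing
  where
  free : Maybe Name → Bool
  free nothing  = true
  free (just _) = false

unify : Pat → Pat → Maybe (Subst Pat × Subst Pat)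
unify (var x)  (var y)  = if eqN x y then just ([] , []) else nothing
unify (var x)  (prot y) = if eqN x y then just ([] , []) else nothing
unify (prot x) (var y)  = if eqN x y then just ([] , []) else nothing
unify (prot x) (prot y) = if eqN x y then just ([] , []) else nothing
unify (bind x) q = if communicable q then just ((x , q) ∷ [] , []) else nothing
unify p (bind x) = if communicable p then just ([] , (x , p) ∷ []) else nothing
unify (p₁ • p₂) (q₁ • q₂) =
  unify p₁ q₁ >>= λ { (σ₁ , ρ₁) →
  unify p₂ q₂ >>= λ { (σ₂ , ρ₂) →
  σ₁ ∪ₚ σ₂ >>= λ σ →
  ρ₁ ∪ₚ ρ₂ >>= λ ρ →
  just (σ , ρ) } }
unify _ _ = nothing

data Field : Set where
  bindF : Name → Field
  protF : Name → Field

bvarsT : List Field → List Name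
bvarsT [] = []
bvarsT (bindF x ∷ ts) = x ∷ bvarsT ts
bvarsT (protF b ∷ ts) = bvarsT ts

namesT : List Field → List Name
namesT [] = []
namesT (bindF x ∷ ts) = x ∷ namesT ts
namesT (protF b ∷ ts) = b ∷ namesT ts

Match : List Field → List Name → Maybe (Subst Name)
Match [] [] = just []
Match (protF c ∷ ts) (b ∷ bs) =
  if eqN c b then (Match ts bs >>= λ σ₂ → [] ⊎ₙ σ₂) else nothing
Match (bindF x ∷ ts) (b ∷ bs) = Match ts bs >>= λ σ₂ → ((x , b) ∷ []) ⊎ₙ σ₂
Match _ _ = nothing

-- The encodings patt and patb (for the fixed name 𝗇).
-- The fresh names are supplied explicitly: x for patt( ), and one
-- name per binder for patb.

fieldPat : Field → Pat
fieldPat (bindF x) = bind x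
fieldPat (protF b) = prot b

patt : Name → Name → List Field → Pat
patt 𝗇 x [] = bind x • var 𝗇
patt 𝗇 x (t ∷ ts) = fieldPat t • var 𝗇 • patt 𝗇 x ts

patb : Name → (bs : List Name) → Vec Name (suc (length bs)) → Pat
patb 𝗇 [] (x ∷ []) = var 𝗇 • bind x
patb 𝗇 (b ∷ bs) (x ∷ xs) = var b • bind x • patb 𝗇 bs xs

liftS : Subst Name → Subst Pat
liftS σ = map (λ { (y , b) → (y , var b) }) σ

MatchIs : List Field → List Name → Subst Name → Set
MatchIs ts bs σ = ∃ λ σ' → Match ts bs ≡ just σ' × σ' ≈ₛ σ

UnifyIs : Pat → Pat → Subst Pat → Subst Pat → Set
UnifyIs p q σ ρ = ∃ λ r → unify p q ≡ just r × (proj₁ r ≈ₛ σ) × (proj₂ r ≈ₛ ρ)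

module Submission where

-- The heart of the proof is a simulation lemma (unify-patt-patb): by
-- induction on the template, the unification of patt(t̃) with patb(b̃)
-- succeeds exactly when Match(t̃; b̃) does, and then returns the matching
-- substitution (with names read as variable patterns) followed by the
-- binding {𝗇/x}, together with {𝗇/xᵢ} for every binder of patb(b̃).
-- Each step of the induction unifies the field with a name b and 𝗇 with
-- a fresh binder; the unions involved are defined because the template
-- binds each variable at most once (Match-dom) and all binders of patb
-- are sent to the same pattern 𝗇.

open import Defs
open import Data.Nat using (suc)
open import Data.List using (List; []; _∷_; _++_; map; length)
open import Data.List.Membership.Propositional using (_∈_; _∉_)
open import Data.List.Membership.Propositional.Properties using (∈-++⁺ʳ)
open import Data.List.Relation.Unary.All using (All; _∷_)
open import Data.List.Relation.Unary.All.Properties using (All¬⇒¬Any)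
open import Data.List.Relation.Unary.AllPairs using (_∷_)
open import Data.List.Relation.Unary.Any using (here; there)
open import Data.List.Relation.Unary.Unique.Propositional using (Unique)
open import Data.Vec using (Vec; toList)
import Data.Vec as Vec
open import Data.Product using (_,_)
open import Data.Sum using (_⊎_; inj₁; inj₂)
open import Data.Bool using (true; false; if_then_else_)
open import Data.Maybe using (just; nothing; _>>=_; _<∣>_)
import Data.Maybe as Maybe
open import Data.Maybe.Properties using (map-injective; <∣>-identityʳ)
open import Data.Empty using (⊥-elim)
open import Function.Bundles using (_⇔_; mk⇔)
open import Relation.Nullary using (yes; no; Dec; does)
open import Relation.Nullary.Decidable using (dec-true; dec-false)
open import Relation.Binary.PropositionalEquality
  using (_≡_; _≢_; refl; sym; trans; cong)
open import Data.Nat.Properties using (_≟_)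

eqN-refl : ∀ x → eqN x x ≡ true
eqN-refl x = dec-true (x ≟ x) refl

eqN-≢ : ∀ {x y} → x ≢ y → eqN x y ≡ false
eqN-≢ {x} {y} x≢y = dec-false (x ≟ y) x≢y

eqN-sound : ∀ {x y} → eqN x y ≡ true → x ≡ y
eqN-sound {x} {y} = sound (x ≟ y)
  where
  sound : (d : Dec (x ≡ y)) → does d ≡ true → x ≡ y
  sound (yes x≡y) _ = x≡y
  sound (no _)    ()

eqP-refl : ∀ p → eqP p p ≡ true
eqP-refl (bind x) = eqN-refl x
eqP-refl (var x)  = eqN-refl x
eqP-refl (prot x) = eqN-refl x
eqP-refl (p • q) rewrite eqP-refl p | eqP-refl q = refl

lookup-++ : ∀ {A : Set} (σ τ : Subst A) z →
  lookup (σ ++ τ) z ≡ (lookup σ z <∣> lookup τ z)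
lookup-++ [] τ z = refl
lookup-++ ((y , a) ∷ σ) τ z with eqN y z
... | true  = refl
... | false = lookup-++ σ τ z

lookup-∉ : ∀ {A : Set} (σ : Subst A) {z} → z ∉ dom σ → lookup σ z ≡ nothing
lookup-∉ [] _ = refl
lookup-∉ ((y , a) ∷ σ) {z} z∉ with eqN y z in y=z
... | true  = ⊥-elim (z∉ (here (sym (eqN-sound y=z))))
... | false = lookup-∉ σ (λ z∈ → z∉ (there z∈))

lookup-liftS : ∀ σ z → lookup (liftS σ) z ≡ Maybe.map var (lookup σ z)
lookup-liftS [] z = refl
lookup-liftS ((y , b) ∷ σ) z with eqN y z
... | true  = refl
... | false = lookup-liftS σ z

lookup-liftS-∉ : ∀ σ {z} → lookup σ z ≡ nothing → lookup (liftS σ) z ≡ nothing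
lookup-liftS-∉ σ {z} σz≡nothing = trans (lookup-liftS σ z) (cong (Maybe.map var) σz≡nothing)

snoc-fresh : ∀ {A : Set} (σ : Subst A) x a → lookup σ x ≡ nothing →
  (σ ++ (x , a) ∷ []) ≈ₛ ((x , a) ∷ σ)
snoc-fresh σ x a σx≡nothing y rewrite lookup-++ σ ((x , a) ∷ []) y
  with eqN x y in x=y
... | false = <∣>-identityʳ (lookup σ y)
... | true with refl ← eqN-sound {x} {y} x=y rewrite σx≡nothing = refl

snoc-unbound : ∀ {A : Set} (σ : Subst A) x a {z} → lookup σ z ≡ nothing → x ≢ z →
  lookup (σ ++ (x , a) ∷ []) z ≡ nothing
snoc-unbound σ x a {z} σz≡nothing x≢z
  rewrite lookup-++ σ ((x , a) ∷ []) z | σz≡nothing | eqN-≢ x≢z = refl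

cons-cong : ∀ {A : Set} (σ τ : Subst A) x a → σ ≈ₛ τ → ((x , a) ∷ σ) ≈ₛ ((x , a) ∷ τ)
cons-cong σ τ x a σ≈τ y with eqN x y
... | true  = refl
... | false = σ≈τ y

cons-cancel : ∀ {A : Set} (σ τ : Subst A) x a → lookup σ x ≡ lookup τ x →
  ((x , a) ∷ σ) ≈ₛ ((x , a) ∷ τ) → σ ≈ₛ τ
cons-cancel σ τ x a σx≡τx eq y with eqN x y in x=y | eq y
... | true  | _ with refl ← eqN-sound {x} {y} x=y = σx≡τx
... | false | σy≡τy = σy≡τy

liftS-cancel : ∀ σ τ → liftS σ ≈ₛ liftS τ → σ ≈ₛ τ
liftS-cancel σ τ eq y = map-injective var-injective
  (trans (sym (lookup-liftS σ y)) (trans (eq y) (lookup-liftS τ y)))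
  where
  var-injective : ∀ {a b} → var a ≡ var b → a ≡ b
  var-injective refl = refl

liftS-cong : ∀ σ τ → σ ≈ₛ τ → liftS σ ≈ₛ liftS τ
liftS-cong σ τ eq y =
  trans (lookup-liftS σ y) (trans (cong (Maybe.map var) (eq y)) (sym (lookup-liftS τ y)))

⊎ₙ-just : ∀ (σ τ : Subst Name) {ρ} → σ ⊎ₙ τ ≡ just ρ → ρ ≡ σ ++ τ
⊎ₙ-just σ τ = guarded-just _
  where
  guarded-just : ∀ c {ρ} → (if c then just (σ ++ τ) else nothing) ≡ just ρ → ρ ≡ σ ++ τ
  guarded-just true  refl = refl
  guarded-just false ()

⊎ₙ-singleton : ∀ (σ : Subst Name) z b → lookup σ z ≡ nothing →
  ((z , b) ∷ []) ⊎ₙ σ ≡ just ((z , b) ∷ σ)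
⊎ₙ-singleton σ z b σz≡nothing rewrite σz≡nothing = refl

Compatible : Subst Pat → Name → Pat → Set
Compatible τ z a = (lookup τ z ≡ nothing) ⊎ (lookup τ z ≡ just a)

∪ₚ-singleton : ∀ (τ : Subst Pat) z a → Compatible τ z a →
  ((z , a) ∷ []) ∪ₚ τ ≡ just ((z , a) ∷ τ)
∪ₚ-singleton τ z a (inj₁ τz≡nothing) rewrite τz≡nothing = refl
∪ₚ-singleton τ z a (inj₂ τz≡a) rewrite τz≡a | eqP-refl a = refl

-- The substitution sending every name of a list to 𝗇, as produced by
-- unification for the binders of patb.
toN : Name → List Name → Subst Pat
toN 𝗇 zs = map (λ y → (y , var 𝗇)) zs

toN-compatible : ∀ 𝗇 zs z → Compatible (toN 𝗇 zs) z (var 𝗇)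
toN-compatible 𝗇 [] z = inj₁ refl
toN-compatible 𝗇 (y ∷ zs) z with eqN y z
... | true  = inj₂ refl
... | false = toN-compatible 𝗇 zs z

Match-dom : ∀ ts bs {σ} → Match ts bs ≡ just σ →
  ∀ {z} → z ∉ bvarsT ts → lookup σ z ≡ nothing
Match-dom [] [] refl _ = refl
Match-dom (protF c ∷ ts) (b ∷ bs) eq z∉ with eqN c b | Match ts bs in rec
... | true | just σ₂ with refl ← eq = Match-dom ts bs rec z∉
Match-dom (bindF y ∷ ts) (b ∷ bs) eq {z} z∉ with Match ts bs in rec
... | just σ₂ with refl ← ⊎ₙ-just ((y , b) ∷ []) σ₂ eq with eqN y z in y=z
...   | true  = ⊥-elim (z∉ (here (sym (eqN-sound y=z))))
...   | false = Match-dom ts bs rec (λ z∈ → z∉ (there z∈))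

unify-patt-patb : ∀ 𝗇 x ts bs xs → Unique (bvarsT ts) → x ∉ bvarsT ts →
  unify (patt 𝗇 x ts) (patb 𝗇 bs xs) ≡
  (Match ts bs >>= λ σ → just (liftS σ ++ (x , var 𝗇) ∷ [] , toN 𝗇 (bn (patb 𝗇 bs xs))))
unify-patt-patb 𝗇 x [] [] (y Vec.∷ Vec.[]) _ _ = refl
unify-patt-patb 𝗇 x [] (b ∷ bs) (y Vec.∷ ys) _ _ = refl
unify-patt-patb 𝗇 x (bindF _ ∷ ts) [] (y Vec.∷ Vec.[]) _ _ = refl
unify-patt-patb 𝗇 x (protF _ ∷ ts) [] (y Vec.∷ Vec.[]) _ _ = refl
-- (The unions are rewritten at the unfolded form of toN, which is how they
-- occur in the reduced goal.)
unify-patt-patb 𝗇 x (protF c ∷ ts) (b ∷ bs) (y Vec.∷ ys) uniq x∉ with eqN c b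
... | false = refl
... | true rewrite unify-patt-patb 𝗇 x ts bs ys uniq x∉ with Match ts bs
...   | nothing = refl
...   | just σ₂
  rewrite ∪ₚ-singleton (map (λ y → (y , var 𝗇)) (bn (patb 𝗇 bs ys))) y (var 𝗇)
                       (toN-compatible 𝗇 (bn (patb 𝗇 bs ys)) y) = refl
unify-patt-patb 𝗇 x (bindF z ∷ ts) (b ∷ bs) (y Vec.∷ ys) (z∉ts ∷ uniq) x∉
  rewrite unify-patt-patb 𝗇 x ts bs ys uniq (λ x∈ → x∉ (there x∈))
  with Match ts bs in rec
... | nothing = refl
... | just σ₂ with Match-dom ts bs rec (All¬⇒¬Any z∉ts)
...   | σ₂z≡nothing
  rewrite ∪ₚ-singleton (map (λ y → (y , var 𝗇)) (bn (patb 𝗇 bs ys))) y (var 𝗇)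
                       (toN-compatible 𝗇 (bn (patb 𝗇 bs ys)) y)
        | ⊎ₙ-singleton σ₂ z b σ₂z≡nothing
        | ∪ₚ-singleton (liftS σ₂ ++ (x , var 𝗇) ∷ []) z (var b)
            (inj₁ (snoc-unbound (liftS σ₂) x (var 𝗇) (lookup-liftS-∉ σ₂ σ₂z≡nothing)
                     (λ x≡z → x∉ (here x≡z))))
  = refl

match-snoc-fresh : ∀ ts bs {σ} 𝗇 {x} → Match ts bs ≡ just σ → x ∉ bvarsT ts →
  (liftS σ ++ (x , var 𝗇) ∷ []) ≈ₛ ((x , var 𝗇) ∷ liftS σ)
match-snoc-fresh ts bs {σ} 𝗇 {x} m x∉ts =
  snoc-fresh (liftS σ) x (var 𝗇) (lookup-liftS-∉ σ (Match-dom ts bs m x∉ts))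

bvarsT⊆namesT : ∀ ts {z} → z ∈ bvarsT ts → z ∈ namesT ts
bvarsT⊆namesT (bindF y ∷ ts) (here z≡y) = here z≡y
bvarsT⊆namesT (bindF y ∷ ts) (there z∈) = there (bvarsT⊆namesT ts z∈)
bvarsT⊆namesT (protF c ∷ ts) z∈ = there (bvarsT⊆namesT ts z∈)

lemma4p6 : (𝗇 : Name) (ts : List Field) (bs : List Name) (σ : Subst Name)
    (x : Name) (xs : Vec Name (suc (length bs))) →
    Unique (bvarsT ts) →
    Unique (x ∷ toList xs) →
    All (λ y → y ∉ (𝗇 ∷ bs ++ namesT ts)) (x ∷ toList xs) →
    x ∉ dom σ →
    (∀ y → ((y ∈ dom σ) ⊎ (y ≡ x)) ⇔ (y ∈ bn (patt 𝗇 x ts))) →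
    MatchIs ts bs σ ⇔
    UnifyIs (patt 𝗇 x ts) (patb 𝗇 bs xs)
    ((x , var 𝗇) ∷ liftS σ)
    (map (λ y → (y , var 𝗇)) (bn (patb 𝗇 bs xs)))
lemma4p6 𝗇 ts bs σ x xs uniq _ (x-fresh ∷ _) x∉σ _ = mk⇔ match⇒unify unify⇒match
  where
  x∉ts : x ∉ bvarsT ts
  x∉ts x∈ = x-fresh (there (∈-++⁺ʳ bs (bvarsT⊆namesT ts x∈)))

  simulation : unify (patt 𝗇 x ts) (patb 𝗇 bs xs) ≡
    (Match ts bs >>= λ σ' → just (liftS σ' ++ (x , var 𝗇) ∷ [] , toN 𝗇 (bn (patb 𝗇 bs xs))))
  simulation = unify-patt-patb 𝗇 x ts bs xs uniq x∉ts

  match⇒unify : MatchIs ts bs σ → UnifyIs (patt 𝗇 x ts) (patb 𝗇 bs xs)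
    ((x , var 𝗇) ∷ liftS σ) (toN 𝗇 (bn (patb 𝗇 bs xs)))
  match⇒unify (σ' , m , σ'≈σ) = _ , trans simulation (cong (_>>= _) m)
    , (λ y → trans (match-snoc-fresh ts bs 𝗇 m x∉ts y) (cons-cong (liftS σ') (liftS σ) x (var 𝗇)
                   (liftS-cong σ' σ σ'≈σ) y))
    , λ _ → refl

  unify⇒match : UnifyIs (patt 𝗇 x ts) (patb 𝗇 bs xs)
    ((x , var 𝗇) ∷ liftS σ) (toN 𝗇 (bn (patb 𝗇 bs xs))) → MatchIs ts bs σ
  unify⇒match (r , u , r₁≈ , _) with Match ts bs in m | trans (sym simulation) u
  ... | just σ' | refl = σ' , refl , liftS-cancel σ' σ
    (cons-cancel (liftS σ') (liftS σ) x (var 𝗇) x-unbound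
      (λ y → trans (sym (match-snoc-fresh ts bs 𝗇 m x∉ts y)) (r₁≈ y)))
    where
    x-unbound : lookup (liftS σ') x ≡ lookup (liftS σ) x
    x-unbound = trans (lookup-liftS-∉ σ' (Match-dom ts bs m x∉ts))
                      (sym (lookup-liftS-∉ σ (lookup-∉ σ x∉σ)))
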